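{- Let $R(x,y,z,s)=\sum_{n\ge0}\sum_I x^n y^{a_y(I)}z^{a_z(I)}s^{a_s(I)}$, where $I$ ranges over independent sets of the graph $H_n$ and $a_c(I)$ is the number of $v\in I$ with $\psi(v,I)=c$. Then \[R=1+x(s+1)R+\frac{xy(z+1)(R-1)}{1-x(y+1)}.\]
   Context: $B_n=\{(i,j):1\le i\le j\le n\}$ ($B_0=\emptyset$), with $i$ the row (row 1 on top) and $j$ the column; cells $(i,i)$ form the leading diagonal. $H_n$ (denoted $\mathcal{U}(B_n)\vee\mathcal{DR}(B_{n-1})$) is the graph on $B_n$ in which distinct cells $(i,j),(k,\ell)$ are adjacent iff either (a) $i>k$ and $j<\ell$ (or the same with the cells swapped), or (b) both cells are off the leading diagonal ($i<j$, $k<\ell$) and either $i=k$, or $i<k$, $j<\ell$ and $\{i,\dots,k\}\times\{j-1,\dots,\ell-1\}\subseteq B_{n-1}$ (or the same with the cells swapped). For an independent set $I$ and $v\in I$: $\psi(v,I)=y$ if $v$ is not on the leading diagonal; for a diagonal $v$, $\psi(v,I)=z$ if $I$ contains another cell in the same column as $v$, and $\psi(v,I)=s$ otherwise. The empty set counts as an independent set. -}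

module Defs where

open import Data.Nat using (ℕ; zero; suc; _∸_; _<ᵇ_; _≡ᵇ_; _≤ᵇ_)
open import Data.Bool using (Bool; true; false; _∧_; _∨_; not; if_then_else_)
open import Data.Product using (_×_; _,_)
open import Data.List using (List; []; _∷_; _++_; map; concatMap; upTo; foldr)
open import Data.Bool.ListAction using (all; any)
open import Algebra.Bundles using (CommutativeRing)
open import Level using (Level)

Cell : Set
Cell = ℕ × ℕ   -- (row i, column j)

-- [a .. b] as a list of naturals (empty if b < a)
range : ℕ → ℕ → List ℕ
range a b = map (λ t → a Data.Nat.+ t) (upTo (suc b ∸ a))

inB : ℕ → Cell → Bool
inB m (i , j) = (1 ≤ᵇ i) ∧ (i ≤ᵇ j) ∧ (j ≤ᵇ m)

cells : ℕ → List Cell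
cells n = concatMap (λ i → map (λ j → (i , j)) (range i n)) (range 1 n)

sameCell : Cell → Cell → Bool
sameCell (i , j) (k , l) = (i ≡ᵇ k) ∧ (j ≡ᵇ l)

condA : Cell → Cell → Bool
condA (i , j) (k , l) = (k <ᵇ i) ∧ (j <ᵇ l)

offDiag : Cell → Bool
offDiag (i , j) = i <ᵇ j

rect : ℕ → Cell → Cell → Bool
rect n (i , j) (k , l) =
  (i <ᵇ k) ∧ (j <ᵇ l) ∧
  all (λ a → all (λ b → inB (n ∸ 1) (a , b)) (range (j ∸ 1) (l ∸ 1))) (range i k)

condB : ℕ → Cell → Cell → Bool
condB n (i , j) (k , l) =
  offDiag (i , j) ∧ offDiag (k , l) ∧
  ((i ≡ᵇ k) ∨ rect n (i , j) (k , l) ∨ rect n (k , l) (i , j))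

adjH : ℕ → Cell → Cell → Bool
adjH n u v = not (sameCell u v) ∧
  (condA u v ∨ condA v u ∨ condB n u v)

independent : ℕ → List Cell → Bool
independent n [] = true
independent n (u ∷ us) = all (λ v → not (adjH n u v)) us ∧ independent n us

subsets : {A : Set} → List A → List (List A)
subsets [] = [] ∷ []
subsets (x ∷ xs) = subsets xs ++ map (x ∷_) (subsets xs)

indepSets : ℕ → List (List Cell)
indepSets n = Data.List.filterᵇ (independent n) (subsets (cells n))

module Series {c ℓ : Level} (Rg : CommutativeRing c ℓ) where
  open CommutativeRing Rg

  PS : Set c
  PS = ℕ → Carrier

  _≋_ : PS → PS → Set ℓ
  f ≋ g = ∀ n → f n ≈ g n

  sumTo : ℕ → (ℕ → Carrier) → Carrier
  sumTo zero f = f 0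
  sumTo (suc n) f = sumTo n f + f (suc n)

  const : Carrier → PS
  const a zero = a
  const a (suc n) = 0#

  infixl 6 _⊕_ _⊖_
  infixl 7 _⊛_

  _⊕_ : PS → PS → PS
  (f ⊕ g) n = f n + g n

  _⊖_ : PS → PS → PS
  (f ⊖ g) n = f n - g n

  _⊛_ : PS → PS → PS
  (f ⊛ g) n = sumTo n (λ k → f k * g (n ∸ k))

  X : PS
  X (suc zero) = 1#
  X _ = 0#

  pow : Carrier → ℕ → Carrier
  pow a zero = 1#
  pow a (suc k) = a * pow a k

  -- 1 / (1 - a x) = Σ_k a^k x^k
  geom : Carrier → PS
  geom a k = pow a k

  module Weights (y z s : Carrier) where
    -- ψ(v, I) evaluated at (y, z, s)
    ψ : List Cell → Cell → Carrier
    ψ I (i , j) =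
      if i <ᵇ j then y
      else (if any (λ w → not (sameCell w (i , j)) ∧ (Data.Product.proj₂ w ≡ᵇ j)) I
            then z else s)

    weight : List Cell → Carrier
    weight I = foldr (λ v acc → ψ I v * acc) 1# I

    R : PS
    R n = foldr (λ I acc → weight I + acc) 0# (indepSets n)

-- Let R_n be the coefficient of x^n. Restricted to B_n, adjacency in H_n does not depend on n, and
-- B_{m+1} is its first row on top of a shifted copy of B_m. The corner (1,1) is adjacent to no other
-- cell and always has ψ = s, so it contributes a factor s + 1; write P_m for the sum over the rest,
-- so that R_{m+1} = (s + 1) P_m. The other cells (1, t+2) of the first row are pairwise adjacent.
-- If none of them is chosen, what remains is a copy of B_m. If (1, t+2) is chosen, the compatible
-- cells are the t cells below it in its column, each free with ψ = y, and all cells of rows ≥ t+2;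
-- among those the diagonal cell (t+2, t+2) is free with ψ = z, and the others form a copy of the
-- board counted by P_{m-t-1}. Hence
--   R_{m+1} = (s + 1) R_m + Σ_{t<m} y (y + 1)^t (z + 1) R_{m-t},
-- which is the coefficient of x^{m+1} in the stated identity.

module Submission where

open import Defs
open import Level using (Level)
open import Algebra.Bundles using (CommutativeRing; Semiring)
import Relation.Binary.Reasoning.Setoid as SetoidReasoning
open import Data.Nat using (zero; suc)

module Board where
  open import Function using (_∘_; _$_)
  open import Function.Bundles using (Equivalence)
  open import Data.Nat using (ℕ; zero; suc; _+_; _∸_; _≤_; _<_; z≤n; s≤s; s≤s⁻¹; z<s; _<ᵇ_; _≡ᵇ_; _≤ᵇ_)
  open import Data.Nat.Properties
  open import Data.Bool using (Bool; true; false; _∧_; _∨_; not; T; T?)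
  open import Data.Bool.Properties using (∧-zeroʳ; T-≡; ¬-not)
  open import Data.Product using (_×_; _,_)
  open import Data.List using (List; []; _∷_; _++_; map; applyUpTo; concatMap; filterᵇ; length)
  open import Data.List.Properties using (map-++; map-∘; map-cong; map-applyUpTo; filter-all; filter-none; filter-++)
  open import Data.List.Relation.Unary.All as All using (All; []; _∷_)
  open import Data.List.Relation.Unary.Any using (Any; here; there)
  open import Data.List.Relation.Unary.AllPairs using (AllPairs)
  import Data.List.Relation.Unary.AllPairs.Properties as AllPairs
  import Data.List.Relation.Unary.All.Properties as All
  import Data.List.Relation.Unary.Any.Properties as Any
  open import Data.Bool.ListAction using (all; any)
  open import Data.Empty using (⊥-elim)
  open import Relation.Binary.PropositionalEquality
  open import Relation.Binary.Definitions using (tri<; tri≈; tri>)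
  open ≡-Reasoning

  <ᵇ-true : ∀ {m n} → m < n → (m <ᵇ n) ≡ true
  <ᵇ-true = Equivalence.to T-≡ ∘ <⇒<ᵇ

  <ᵇ-false : ∀ {m n} → n ≤ m → (m <ᵇ n) ≡ false
  <ᵇ-false {m} {n} n≤m = ¬-not λ m<ᵇn → <⇒≱ (<ᵇ⇒< m n (Equivalence.from T-≡ m<ᵇn)) n≤m

  ≤ᵇ-true : ∀ {m n} → m ≤ n → (m ≤ᵇ n) ≡ true
  ≤ᵇ-true = Equivalence.to T-≡ ∘ ≤⇒≤ᵇ

  ≤ᵇ-false : ∀ {m n} → n < m → (m ≤ᵇ n) ≡ false
  ≤ᵇ-false {m} {n} n<m = ¬-not λ m≤ᵇn → <⇒≱ n<m (≤ᵇ⇒≤ m n (Equivalence.from T-≡ m≤ᵇn))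

  ≡ᵇ-refl : ∀ n → (n ≡ᵇ n) ≡ true
  ≡ᵇ-refl n = Equivalence.to T-≡ (≡⇒≡ᵇ n n refl)

  ≡ᵇ-false : ∀ {m n} → m ≢ n → (m ≡ᵇ n) ≡ false
  ≡ᵇ-false {m} {n} m≢n = ¬-not λ m≡ᵇn → m≢n (≡ᵇ⇒≡ m n (Equivalence.from T-≡ m≡ᵇn))

  all-true : ∀ {A : Set} (p : A → Bool) {xs} → All (λ x → p x ≡ true) xs → all p xs ≡ true
  all-true p [] = refl
  all-true p (px ∷ pxs) rewrite px = all-true p pxs

  all-false : ∀ {A : Set} (p : A → Bool) {xs} → Any (λ x → p x ≡ false) xs → all p xs ≡ false
  all-false p (here px) rewrite px = refl
  all-false p {x ∷ _} (there any) rewrite all-false p any = ∧-zeroʳ (p x)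

  any-false : ∀ {A : Set} (p : A → Bool) {xs} → All (λ x → p x ≡ false) xs → any p xs ≡ false
  any-false p [] = refl
  any-false p (px ∷ pxs) rewrite px = any-false p pxs

  all-cong : ∀ {A : Set} {P : A → Set} (p q : A → Bool) {xs} →
    All P xs → (∀ {x} → P x → p x ≡ q x) → all p xs ≡ all q xs
  all-cong p q [] p≗q = refl
  all-cong p q (px ∷ pxs) p≗q = cong₂ _∧_ (p≗q px) (all-cong p q pxs p≗q)

  all-map : ∀ {A B : Set} (p : B → Bool) (f : A → B) xs → all p (map f xs) ≡ all (p ∘ f) xs
  all-map p f [] = refl
  all-map p f (x ∷ xs) = cong (p (f x) ∧_) (all-map p f xs)

  any-map : ∀ {A B : Set} (p : B → Bool) (f : A → B) xs → any p (map f xs) ≡ any (p ∘ f) xs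
  any-map p f [] = refl
  any-map p f (x ∷ xs) = cong (p (f x) ∨_) (any-map p f xs)

  range-All : ∀ {P : ℕ → Set} a b → (∀ {t} → a ≤ t → t ≤ b → P t) → All P (range a b)
  range-All a b P[a,b] = All.map⁺ $ All.applyUpTo⁺₁ _ (suc b ∸ a)
    λ {t} t<1+b∸a → P[a,b] (m≤m+n a t) (offset≤ a b t<1+b∸a)
    where
    offset≤ : ∀ a b {t} → t < suc b ∸ a → a + t ≤ b
    offset≤ zero b lt = s≤s⁻¹ lt
    offset≤ (suc a) zero lt rewrite 0∸n≡0 a = ⊥-elim (n≮0 lt)
    offset≤ (suc a) (suc b) lt = s≤s (offset≤ a b lt)

  range-Any : ∀ {P : ℕ → Set} a b {t} → a ≤ t → t ≤ b → P t → Any P (range a b)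
  range-Any {P} a b {t} a≤t t≤b Pt = Any.map⁺ $ Any.applyUpTo⁺ (λ d → d) {t ∸ a}
    (subst P (sym (m+[n∸m]≡n a≤t)) Pt)
    (offset< a b (subst (_≤ b) (sym (m+[n∸m]≡n a≤t)) t≤b))
    where
    offset< : ∀ a b {d} → a + d ≤ b → d < suc b ∸ a
    offset< zero b le = s≤s le
    offset< (suc a) (suc b) (s≤s le) = offset< a b le

  applyUpTo-cong : ∀ {A : Set} {f g : ℕ → A} n → (∀ t → f t ≡ g t) → applyUpTo f n ≡ applyUpTo g n
  applyUpTo-cong zero f≗g = refl
  applyUpTo-cong (suc n) f≗g = cong₂ _∷_ (f≗g 0) (applyUpTo-cong n (f≗g ∘ suc))

  range-cons : ∀ {a b} → a ≤ b → range a b ≡ a ∷ range (suc a) b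
  range-cons {a} {b} a≤b rewrite +-∸-assoc 1 a≤b = cong₂ _∷_ (+-identityʳ a) (begin
    map (a +_) (applyUpTo suc (b ∸ a))     ≡⟨ map-applyUpTo suc (a +_) (b ∸ a) ⟩
    applyUpTo (λ t → a + suc t) (b ∸ a)    ≡⟨ applyUpTo-cong (b ∸ a) (+-suc a) ⟩
    applyUpTo (suc a +_) (b ∸ a)           ≡⟨ map-applyUpTo (λ t → t) (suc a +_) (b ∸ a) ⟨
    map (suc a +_) (applyUpTo (λ t → t) (b ∸ a)) ∎)

  -- For cells of B_N, the rectangle {i..k} × {j-1..l-1} lies in B_{N-1} exactly when k < j.
  rect′ : Cell → Cell → Bool
  rect′ (i , j) (k , l) = (i <ᵇ k) ∧ (j <ᵇ l) ∧ (k <ᵇ j)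

  rect≡rect′ : ∀ {N i j k l} → 1 ≤ i → l ≤ N → rect N (i , j) (k , l) ≡ rect′ (i , j) (k , l)
  rect≡rect′ {N} {i} {j} {k} {l} 1≤i l≤N with i <ᵇ k in i<ᵇk | j <ᵇ l in j<ᵇl
  ... | false | _ = refl
  ... | true | false = refl
  ... | true | true with k <ᵇ j in k<ᵇj
  ... | true = all-true _ $ range-All i k λ i≤a a≤k → all-true _ $ range-All (j ∸ 1) (l ∸ 1) λ j-1≤b b≤l-1 →
    cong₂ _∧_ (≤ᵇ-true (≤-trans 1≤i i≤a))
      (cong₂ _∧_ (≤ᵇ-true (≤-trans a≤k (≤-trans k≤j-1 j-1≤b))) (≤ᵇ-true (≤-trans b≤l-1 (∸-monoˡ-≤ 1 l≤N))))
    where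
    k≤j-1 : k ≤ j ∸ 1
    k≤j-1 = m+n≤o⇒m≤o∸n k (subst (_≤ j) (+-comm 1 k) (<ᵇ⇒< k j (Equivalence.from T-≡ k<ᵇj)))
  ... | false = all-false _ $ range-Any i k (<⇒≤ i<k) ≤-refl $
    all-false _ $ range-Any (j ∸ 1) (l ∸ 1) ≤-refl (∸-monoˡ-≤ 1 (<⇒≤ j<l)) $
    cong₂ _∧_ (≤ᵇ-true 1≤k) (cong (_∧ _) (≤ᵇ-false j-1<k))
    where
    i<k = <ᵇ⇒< i k (Equivalence.from T-≡ i<ᵇk)
    j<l = <ᵇ⇒< j l (Equivalence.from T-≡ j<ᵇl)
    1≤k = ≤-trans 1≤i (<⇒≤ i<k)
    j-1<k : j ∸ 1 < k
    j-1<k = pred< {j} (≮⇒≥ λ k<j → subst T k<ᵇj (<⇒<ᵇ k<j)) (<-≤-trans 1≤i (<⇒≤ i<k))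
      where
      pred< : ∀ {j k} → j ≤ k → 0 < k → j ∸ 1 < k
      pred< {zero} _ 0<k = 0<k
      pred< {suc _} j<k _ = j<k

  adj : Cell → Cell → Bool
  adj (i , j) (k , l) = not (sameCell (i , j) (k , l)) ∧
    (condA (i , j) (k , l) ∨ condA (k , l) (i , j) ∨
     offDiag (i , j) ∧ offDiag (k , l) ∧ ((i ≡ᵇ k) ∨ rect′ (i , j) (k , l) ∨ rect′ (k , l) (i , j)))

  InBoard : ℕ → Cell → Set
  InBoard N (i , j) = 1 ≤ i × i ≤ j × j ≤ N

  adjH≡adj : ∀ {N u v} → InBoard N u → InBoard N v → adjH N u v ≡ adj u v
  adjH≡adj {N} {i , j} {k , l} (1≤i , _ , j≤N) (1≤k , _ , l≤N)
    rewrite rect≡rect′ {N} {i} {j} {k} {l} 1≤i l≤N | rect≡rect′ {N} {k} {l} {i} {j} 1≤k j≤N = refl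

  indep : List Cell → Bool
  indep [] = true
  indep (u ∷ us) = all (not ∘ adj u) us ∧ indep us

  independent≡indep : ∀ {N S} → All (InBoard N) S → independent N S ≡ indep S
  independent≡indep [] = refl
  independent≡indep {N} (u∈B ∷ S⊆B) =
    cong₂ _∧_ (all-cong _ _ S⊆B (cong not ∘ adjH≡adj {N} u∈B)) (independent≡indep S⊆B)

  diagonal-nonadj : ∀ {a r c} → a ≤ r → a < c → adj (a , a) (r , c) ≡ false
  diagonal-nonadj {a} {r} {c} a≤r a<c
    rewrite <ᵇ-false {r} {a} a≤r | <ᵇ-false {c} {a} (<⇒≤ a<c) | <ᵇ-false {a} {a} ≤-refl
          | ∧-zeroʳ (a <ᵇ r) = ∧-zeroʳ _

  sameRow-adj : ∀ {i j l} → i < j → i < l → j ≢ l → adj (i , j) (i , l) ≡ true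
  sameRow-adj {i} {j} {l} i<j i<l j≢l
    rewrite ≡ᵇ-refl i | ≡ᵇ-false j≢l | <ᵇ-false {i} {i} ≤-refl | <ᵇ-true i<j | <ᵇ-true i<l = refl

  sameColumn-nonadj : ∀ {r r' j} → r < j → r' < j → adj (r , j) (r' , j) ≡ false
  sameColumn-nonadj {r} {r'} {j} r<j r'<j with r ≡ᵇ r'
  ... | true rewrite ≡ᵇ-refl j = refl
  ... | false rewrite <ᵇ-false {j} {j} ≤-refl | ∧-zeroʳ (r' <ᵇ r) | ∧-zeroʳ (r <ᵇ r')
                    | <ᵇ-true r<j | <ᵇ-true r'<j = refl

  belowDiagonal-nonadj : ∀ {r j r' c'} → r < j → j ≤ r' → r' ≤ c' → adj (r , j) (r' , c') ≡ false
  belowDiagonal-nonadj {r} {j} {r'} {c'} r<j j≤r' r'≤c'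
    rewrite ≡ᵇ-false {r} {r'} (<⇒≢ (<-≤-trans r<j j≤r'))
          | <ᵇ-false {r'} {r} (<⇒≤ (<-≤-trans r<j j≤r')) | <ᵇ-false {c'} {j} (≤-trans j≤r' r'≤c') | <ᵇ-false {r'} {j} j≤r'
          | ∧-zeroʳ (r <ᵇ r') | ∧-zeroʳ (j <ᵇ c') | ∧-zeroʳ (r <ᵇ r')
          | ∧-zeroʳ (r' <ᵇ c') | ∧-zeroʳ (r <ᵇ j) = refl

  crossing-adj : ∀ {i j r c} → i < r → r < j → r ≤ c → c ≢ j → adj (i , j) (r , c) ≡ true
  crossing-adj {i} {j} {r} {c} i<r r<j r≤c c≢j with <-cmp c j
  ... | tri< c<j _ _
    rewrite ≡ᵇ-false {i} {r} (<⇒≢ i<r) | <ᵇ-false {r} {i} (<⇒≤ i<r) | <ᵇ-true i<r | <ᵇ-true c<j = refl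
  ... | tri≈ _ c≡j _ = ⊥-elim (c≢j c≡j)
  ... | tri> _ _ j<c
    rewrite ≡ᵇ-false {i} {r} (<⇒≢ i<r) | <ᵇ-false {r} {i} (<⇒≤ i<r) | <ᵇ-false {c} {j} (<⇒≤ j<c)
          | <ᵇ-true i<r | <ᵇ-true j<c | <ᵇ-true r<j | <ᵇ-true (<-trans i<r r<j) | <ᵇ-true (<-trans r<j j<c) = refl

  ≤-shift : ∀ a {n i} → n ≤ i → n + a ≤ a + i
  ≤-shift a {n} {i} n≤i = subst (_≤ a + i) (+-comm a n) (+-monoʳ-≤ a n≤i)

  shift : ℕ → Cell → Cell
  shift a (i , j) = (a + i , a + j)

  shift-suc : ∀ a c → shift (suc a) c ≡ shift a (shift 1 c)
  shift-suc a (i , j) = sym (cong₂ _,_ (+-suc a i) (+-suc a j))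

  map-shift-suc : ∀ a L → map (shift (suc a)) L ≡ map (shift a) (map (shift 1) L)
  map-shift-suc a L = trans (map-cong (shift-suc a) L) (map-∘ L)

  map-shift-zero : ∀ L → map (shift 0) L ≡ L
  map-shift-zero [] = refl
  map-shift-zero (c ∷ L) = cong (c ∷_) (map-shift-zero L)

  indep-shift : ∀ S → indep (map (shift 1) S) ≡ indep S
  indep-shift [] = refl
  indep-shift (u ∷ S) = cong₂ _∧_ (all-map (not ∘ adj (shift 1 u)) (shift 1) S) (indep-shift S)

  firstRow : ℕ → List Cell
  firstRow m = applyUpTo (λ t → (1 , suc t)) m

  board : ℕ → List Cell
  board zero = []
  board (suc m) = firstRow (suc m) ++ map (shift 1) (board m)

  board-InBoard : ∀ n → All (InBoard n) (board n)
  board-InBoard zero = []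
  board-InBoard (suc m) = All.++⁺ (All.applyUpTo⁺₁ _ (suc m) λ t<1+m → s≤s z≤n , s≤s z≤n , t<1+m)
    (All.map⁺ (All.map (λ { {i , j} (1≤i , i≤j , j≤m) → s≤s z≤n , s≤s i≤j , s≤s j≤m }) (board-InBoard m)))

  cells≡board : ∀ n → cells n ≡ board n
  cells≡board n = trans (rowsFrom 0 n refl) (map-shift-zero (board n))
    where
    row : ℕ → List Cell
    row i = map (i ,_) (range i n)

    rowsFrom : ∀ a m → n ≡ a + m → concatMap row (range (suc a) n) ≡ map (shift a) (board m)
    rowsFrom a zero n≡a+0 rewrite n≡a+0 | +-identityʳ a | n∸n≡0 a = refl
    rowsFrom a (suc m) n≡a+1+m = begin
      concatMap row (range (suc a) n)
        ≡⟨ cong (concatMap row) (range-cons 1+a≤n) ⟩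
      row (suc a) ++ concatMap row (range (suc (suc a)) n)
        ≡⟨ cong₂ _++_ firstRowEq (rowsFrom (suc a) m (trans n≡a+1+m (+-suc a m))) ⟩
      map (shift a) (firstRow (suc m)) ++ map (shift (suc a)) (board m)
        ≡⟨ cong (map (shift a) (firstRow (suc m)) ++_) (map-shift-suc a (board m)) ⟩
      map (shift a) (firstRow (suc m)) ++ map (shift a) (map (shift 1) (board m))
        ≡⟨ map-++ (shift a) (firstRow (suc m)) (map (shift 1) (board m)) ⟨
      map (shift a) (board (suc m)) ∎
      where
      1+a≤n : suc a ≤ n
      1+a≤n = subst (suc a ≤_) (sym n≡a+1+m) (≤-shift a (s≤s z≤n))
      firstRowEq : row (suc a) ≡ map (shift a) (firstRow (suc m))
      firstRowEq rewrite trans (cong (_∸ a) n≡a+1+m) (m+n∸m≡n a (suc m)) = begin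
        map (suc a ,_) (map (suc a +_) (applyUpTo (λ t → t) (suc m)))
          ≡⟨ map-∘ (applyUpTo (λ t → t) (suc m)) ⟨
        map (λ t → (suc a , suc a + t)) (applyUpTo (λ t → t) (suc m))
          ≡⟨ map-applyUpTo (λ t → t) _ (suc m) ⟩
        applyUpTo (λ t → (suc a , suc a + t)) (suc m)
          ≡⟨ applyUpTo-cong (suc m) (λ t → cong₂ _,_ (+-comm 1 a) (sym (+-suc a t))) ⟩
        applyUpTo (λ t → (a + 1 , a + suc t)) (suc m)
          ≡⟨ map-applyUpTo (λ t → (1 , suc t)) (shift a) (suc m) ⟨
        map (shift a) (firstRow (suc m)) ∎

  topCell : ℕ → Cell
  topCell t = (1 , suc (suc t))

  topRow : ℕ → List Cell
  topRow m = applyUpTo topCell m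

  board∖corner : ℕ → List Cell
  board∖corner m = topRow m ++ map (shift 1) (board m)

  OffFirstColumn : Cell → Set
  OffFirstColumn (i , j) = 1 ≤ i × 2 ≤ j × i ≤ j

  board∖corner-OffFirstColumn : ∀ m → All OffFirstColumn (board∖corner m)
  board∖corner-OffFirstColumn m = All.++⁺ (All.applyUpTo⁺₂ _ m λ _ → s≤s z≤n , s≤s (s≤s z≤n) , s≤s z≤n)
    (All.map⁺ (All.map (λ { {i , j} (1≤i , i≤j , _) → s≤s z≤n , s≤s (≤-trans 1≤i i≤j) , s≤s i≤j }) (board-InBoard m)))

  topRow-adj : ∀ m → AllPairs (λ u v → adj u v ≡ true) (topRow m)
  topRow-adj m = AllPairs.applyUpTo⁺₁ topCell m λ t<t' _ → sameRow-adj (s≤s z≤n) (s≤s z≤n) (<⇒≢ (s≤s (s≤s t<t')))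

  compatible : ℕ → Cell → Bool
  compatible t = not ∘ adj (topCell t)

  column : ℕ → ℕ → ℕ → List Cell
  column t d zero = []
  column t d (suc e) = (suc (suc d) , suc (suc t)) ∷ column t (suc d) e

  filterᵇ-all : ∀ {A : Set} (p : A → Bool) {xs} → All (λ x → p x ≡ true) xs → filterᵇ p xs ≡ xs
  filterᵇ-all p = filter-all (T? ∘ p) ∘ All.map (Equivalence.from T-≡)

  filterᵇ-single : ∀ {A : Set} (p : A → Bool) (g : ℕ → A) {n u} → u < n → p (g u) ≡ true →
    (∀ {v} → v < n → v ≢ u → p (g v) ≡ false) → filterᵇ p (applyUpTo g n) ≡ g u ∷ []
  filterᵇ-single p g {suc n} {zero} _ p[gu] p[gv] rewrite p[gu] =
    cong (g 0 ∷_) (filter-none (T? ∘ p) (All.applyUpTo⁺₁ _ n λ v<n → subst T (p[gv] (s≤s v<n) λ ())))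
  filterᵇ-single p g {suc n} {suc u} u<n p[gu] p[gv] rewrite p[gv] {0} z<s (λ ()) =
    filterᵇ-single p (g ∘ suc) (s≤s⁻¹ u<n) p[gu] λ v<n v≢u → p[gv] (s≤s v<n) (v≢u ∘ suc-injective)

  -- Among the cells of rows ≥ d + 2, those not adjacent to topCell t are the cells of its column
  -- down to row t + 1, and all cells of rows ≥ t + 2.
  filter-compatible : ∀ t k e d → t ≡ d + e →
    filterᵇ (compatible t) (map (shift (suc d)) (board (e + suc k))) ≡ column t d e ++ map (shift (suc t)) (board (suc k))
  filter-compatible t k zero d t≡d+0 rewrite t≡d+0 | +-identityʳ d = filterᵇ-all (compatible d) $
    All.map⁺ $ All.map (λ { {i , l} (1≤i , i≤l , _) → cong not $
      belowDiagonal-nonadj (s≤s (s≤s z≤n)) (≤-shift (suc d) 1≤i) (+-monoʳ-≤ (suc d) i≤l) })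
      (board-InBoard (suc k))
  filter-compatible t k (suc e) d t≡d+1+e = begin
    filterᵇ (compatible t) (map (shift (suc d)) (board (suc e + suc k)))
      ≡⟨ cong (filterᵇ (compatible t)) (map-++ (shift (suc d)) (firstRow (suc q)) (map (shift 1) (board q))) ⟩
    filterᵇ (compatible t) (map (shift (suc d)) (firstRow (suc q)) ++ map (shift (suc d)) (map (shift 1) (board q)))
      ≡⟨ filter-++ (T? ∘ compatible t) (map (shift (suc d)) (firstRow (suc q))) _ ⟩
    filterᵇ (compatible t) (map (shift (suc d)) (firstRow (suc q))) ++ filterᵇ (compatible t) (map (shift (suc d)) (map (shift 1) (board q)))
      ≡⟨ cong₂ _++_ firstRow-compatible (cong (filterᵇ (compatible t)) (sym (map-shift-suc (suc d) (board q)))) ⟩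
    (suc (suc d) , suc (suc t)) ∷ filterᵇ (compatible t) (map (shift (suc (suc d))) (board q))
      ≡⟨ cong (_ ∷_) (filter-compatible t k e (suc d) (trans t≡d+1+e (+-suc d e))) ⟩
    column t d (suc e) ++ map (shift (suc t)) (board (suc k)) ∎
    where
    q = e + suc k
    j = suc (suc t)
    d+2<j : suc (suc d) < j
    d+2<j = s≤s (s≤s (subst (d <_) (sym t≡d+1+e) (m<m+n d z<s)))
    cell : ℕ → Cell
    cell u = (suc (suc d) , suc (suc (d + u)))
    1+e<1+q : suc e < suc q
    1+e<1+q = s≤s (subst (suc e ≤_) (sym (+-suc e k)) (s≤s (m≤m+n e k)))
    columnCell-compatible : compatible t (cell (suc e)) ≡ true
    columnCell-compatible rewrite sym t≡d+1+e = cong not (sameColumn-nonadj (s≤s (s≤s z≤n)) d+2<j)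
    otherCells-incompatible : ∀ {u} → u < suc q → u ≢ suc e → compatible t (cell u) ≡ false
    otherCells-incompatible {u} _ u≢1+e = cong not (crossing-adj (s≤s (s≤s z≤n)) d+2<j (s≤s (s≤s (m≤m+n d u))) column≢j)
      where
      column≢j : suc (suc (d + u)) ≢ j
      column≢j eq = u≢1+e (+-cancelˡ-≡ d _ _ (trans (suc-injective (suc-injective eq)) t≡d+1+e))
    firstRow-compatible : filterᵇ (compatible t) (map (shift (suc d)) (firstRow (suc q))) ≡ (suc (suc d) , j) ∷ []
    firstRow-compatible = begin
      filterᵇ (compatible t) (map (shift (suc d)) (firstRow (suc q)))
        ≡⟨ cong (filterᵇ (compatible t)) (map-applyUpTo (λ u → (1 , suc u)) (shift (suc d)) (suc q)) ⟩
      filterᵇ (compatible t) (applyUpTo (shift (suc d) ∘ λ u → (1 , suc u)) (suc q))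
        ≡⟨ cong (filterᵇ (compatible t)) (applyUpTo-cong (suc q) λ u → cong₂ _,_ (cong suc (+-comm d 1)) (cong suc (+-suc d u))) ⟩
      filterᵇ (compatible t) (applyUpTo cell (suc q))
        ≡⟨ filterᵇ-single (compatible t) cell 1+e<1+q columnCell-compatible otherCells-incompatible ⟩
      cell (suc e) ∷ []
        ≡⟨ cong (λ c → (suc (suc d) , c) ∷ []) (cong (suc ∘ suc) (sym t≡d+1+e)) ⟩
      (suc (suc d) , j) ∷ [] ∎

  ColumnAbove : ℕ → Cell → Set
  ColumnAbove j (r , c) = 2 ≤ r × r < j × c ≡ j

  Below : ℕ → Cell → Set
  Below j (r , c) = j ≤ r × r ≤ c

  SouthEast : ℕ → Cell → Set
  SouthEast j (r , c) = j ≤ r × j < c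

  column-ColumnAbove : ∀ t d e → d + e ≤ t → All (ColumnAbove (suc (suc t))) (column t d e)
  column-ColumnAbove t d zero _ = []
  column-ColumnAbove t d (suc e) d+1+e≤t =
    (s≤s (s≤s z≤n) , s≤s (s≤s (<-≤-trans (m<m+n d z<s) d+1+e≤t)) , refl)
    ∷ column-ColumnAbove t (suc d) e (subst (_≤ t) (+-suc d e) d+1+e≤t)

  length-column : ∀ t d e → length (column t d e) ≡ e
  length-column t d zero = refl
  length-column t d (suc e) = cong suc (length-column t (suc d) e)

  shiftedBoard-Below : ∀ t k → All (Below (suc (suc t))) (map (shift (suc t)) (board k))
  shiftedBoard-Below t k = All.map⁺ (All.map (λ { {i , l} (1≤i , i≤l , _) → ≤-shift (suc t) 1≤i , +-monoʳ-≤ (suc t) i≤l }) (board-InBoard k))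

  shifted∖corner-SouthEast : ∀ t k → All (SouthEast (suc (suc t))) (map (shift (suc t)) (board∖corner k))
  shifted∖corner-SouthEast t k = All.map⁺ $
    All.map (λ { {i , l} (1≤i , 2≤l , _) → ≤-shift (suc t) 1≤i , ≤-shift (suc t) 2≤l }) (board∖corner-OffFirstColumn k)

  shiftedBoard-suc : ∀ t k → map (shift (suc t)) (board (suc k)) ≡ (suc (suc t) , suc (suc t)) ∷ map (shift (suc t)) (board∖corner k)
  shiftedBoard-suc t k = cong (λ a → (a , a) ∷ map (shift (suc t)) (board∖corner k)) (cong suc (+-comm t 1))

module SublistSums {c ℓ} (S : Semiring c ℓ) where
  open import Function using (_∘_)
  open import Data.Bool using (Bool; true; false; _∧_; if_then_else_)
  open import Data.List using (List; []; _∷_; _++_; map; foldr; filterᵇ; length)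
  open import Data.List.Relation.Unary.All using (All; []; _∷_)
  open import Data.List.Relation.Unary.AllPairs using (AllPairs; []; _∷_)
  open import Data.Bool.ListAction using (all)
  import Relation.Binary.PropositionalEquality as ≡

  open Semiring S
  open import Algebra.Definitions.RawSemiring rawSemiring using (_^_)
  open import Relation.Binary.Reasoning.Setoid setoid

  sumOver : ∀ {A : Set} → List A → (A → Carrier) → Carrier
  sumOver xs f = foldr (λ a acc → f a + acc) 0# xs

  sumOver-++ : ∀ {A : Set} (xs ys : List A) f → sumOver (xs ++ ys) f ≈ sumOver xs f + sumOver ys f
  sumOver-++ [] ys f = sym (+-identityˡ _)
  sumOver-++ (x ∷ xs) ys f = trans (+-congˡ (sumOver-++ xs ys f)) (sym (+-assoc _ _ _))

  sumOver-map : ∀ {A B : Set} (g : A → B) xs f → sumOver (map g xs) f ≡.≡ sumOver xs (f ∘ g)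
  sumOver-map g [] f = ≡.refl
  sumOver-map g (x ∷ xs) f = ≡.cong (f (g x) +_) (sumOver-map g xs f)

  sumOver-cong : ∀ {A : Set} {P : A → Set} {xs} {f g : A → Carrier} →
    All P xs → (∀ {x} → P x → f x ≈ g x) → sumOver xs f ≈ sumOver xs g
  sumOver-cong [] f≈g = refl
  sumOver-cong (px ∷ pxs) f≈g = +-cong (f≈g px) (sumOver-cong pxs f≈g)

  sumOver-congF : ∀ {A : Set} xs {f g : A → Carrier} → (∀ x → f x ≈ g x) → sumOver xs f ≈ sumOver xs g
  sumOver-congF [] f≈g = refl
  sumOver-congF (x ∷ xs) f≈g = +-cong (f≈g x) (sumOver-congF xs f≈g)

  sumOver-zero : ∀ {A : Set} (xs : List A) → sumOver xs (λ _ → 0#) ≈ 0#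
  sumOver-zero [] = refl
  sumOver-zero (x ∷ xs) = trans (+-identityˡ _) (sumOver-zero xs)

  sumOver-*ˡ : ∀ {A : Set} (xs : List A) a f → sumOver xs (λ x → a * f x) ≈ a * sumOver xs f
  sumOver-*ˡ [] a f = sym (zeroʳ a)
  sumOver-*ˡ (x ∷ xs) a f = trans (+-congˡ (sumOver-*ˡ xs a f)) (sym (distribˡ a _ _))

  sumSub : ∀ {A : Set} → List A → (List A → Carrier) → Carrier
  sumSub L F = sumOver (subsets L) F

  sumSub-cons : ∀ {A : Set} x (L : List A) F → sumSub (x ∷ L) F ≈ sumSub L F + sumSub L (F ∘ (x ∷_))
  sumSub-cons x L F = trans (sumOver-++ (subsets L) (map (x ∷_) (subsets L)) F)
    (+-congˡ (reflexive (sumOver-map (x ∷_) (subsets L) F)))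

  sumSub-cong : ∀ {A : Set} {P : A → Set} {L} {F G : List A → Carrier} →
    All P L → (∀ {S} → All P S → F S ≈ G S) → sumSub L F ≈ sumSub L G
  sumSub-cong [] F≈G = +-congʳ (F≈G [])
  sumSub-cong {L = x ∷ L} {F} {G} (px ∷ pL) F≈G = begin
    sumSub (x ∷ L) F                        ≈⟨ sumSub-cons x L F ⟩
    sumSub L F + sumSub L (F ∘ (x ∷_))      ≈⟨ +-cong (sumSub-cong pL F≈G) (sumSub-cong pL (F≈G ∘ (px ∷_))) ⟩
    sumSub L G + sumSub L (G ∘ (x ∷_))      ≈⟨ sumSub-cons x L G ⟨
    sumSub (x ∷ L) G                        ∎

  sumSub-congF : ∀ {A : Set} (L : List A) {F G : List A → Carrier} → (∀ S → F S ≈ G S) → sumSub L F ≈ sumSub L G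
  sumSub-congF L = sumOver-congF (subsets L)

  sumSub-map : ∀ {A B : Set} (g : A → B) L F → sumSub (map g L) F ≈ sumSub L (F ∘ map g)
  sumSub-map g [] F = refl
  sumSub-map g (x ∷ L) F = begin
    sumSub (g x ∷ map g L) F                                   ≈⟨ sumSub-cons (g x) (map g L) F ⟩
    sumSub (map g L) F + sumSub (map g L) (F ∘ (g x ∷_))       ≈⟨ +-cong (sumSub-map g L F) (sumSub-map g L (F ∘ (g x ∷_))) ⟩
    sumSub L (F ∘ map g) + sumSub L (F ∘ (g x ∷_) ∘ map g)     ≈⟨ sumSub-cons x L (F ∘ map g) ⟨
    sumSub (x ∷ L) (F ∘ map g)                                 ∎

  sumSub-++ : ∀ {A : Set} (L₁ L₂ : List A) F → sumSub (L₁ ++ L₂) F ≈ sumSub L₁ (λ S₁ → sumSub L₂ (F ∘ (S₁ ++_)))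
  sumSub-++ [] L₂ F = sym (+-identityʳ _)
  sumSub-++ (x ∷ L₁) L₂ F = begin
    sumSub (x ∷ (L₁ ++ L₂)) F                           ≈⟨ sumSub-cons x (L₁ ++ L₂) F ⟩
    sumSub (L₁ ++ L₂) F + sumSub (L₁ ++ L₂) (F ∘ (x ∷_)) ≈⟨ +-cong (sumSub-++ L₁ L₂ F) (sumSub-++ L₁ L₂ (F ∘ (x ∷_))) ⟩
    _                                                   ≈⟨ sumSub-cons x L₁ _ ⟨
    sumSub (x ∷ L₁) (λ S₁ → sumSub L₂ (F ∘ (S₁ ++_)))   ∎

  sumSub-zero : ∀ {A : Set} (L : List A) → sumSub L (λ _ → 0#) ≈ 0#
  sumSub-zero L = sumOver-zero (subsets L)

  sumSub-*ˡ : ∀ {A : Set} (L : List A) a F → sumSub L (λ S → a * F S) ≈ a * sumSub L F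
  sumSub-*ˡ L = sumOver-*ˡ (subsets L)

  sumSub-filter : ∀ {A : Set} (p : A → Bool) L F →
    sumSub L (λ S → if all p S then F S else 0#) ≈ sumSub (filterᵇ p L) F
  sumSub-filter p [] F = refl
  sumSub-filter p (x ∷ L) F with p x in px
  ... | true = begin
    _                                       ≈⟨ sumSub-cons x L _ ⟩
    _                                       ≈⟨ +-cong (sumSub-filter p L F) (trans (sumSub-congF L dropx) (sumSub-filter p L (F ∘ (x ∷_)))) ⟩
    _                                       ≈⟨ sumSub-cons x (filterᵇ p L) F ⟨
    sumSub (x ∷ filterᵇ p L) F              ∎
    where
    dropx : ∀ S → (if p x ∧ all p S then F (x ∷ S) else 0#) ≈ (if all p S then F (x ∷ S) else 0#)
    dropx S rewrite px = refl
  ... | false = begin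
    _                                       ≈⟨ sumSub-cons x L _ ⟩
    _                                       ≈⟨ +-cong (sumSub-filter p L F) (trans (sumSub-congF L killx) (sumSub-zero L)) ⟩
    sumSub (filterᵇ p L) F + 0#             ≈⟨ +-identityʳ _ ⟩
    sumSub (filterᵇ p L) F                  ∎
    where
    killx : ∀ S → (if p x ∧ all p S then F (x ∷ S) else 0#) ≈ 0#
    killx S rewrite px = refl

  sumSub-factor : ∀ {A : Set} {P : A → Set} x {L} a F → All P L →
    (∀ {S} → All P S → F (x ∷ S) ≈ a * F S) → sumSub (x ∷ L) F ≈ (a + 1#) * sumSub L F
  sumSub-factor x {L} a F pL F[x∷S]≈aF[S] = begin
    sumSub (x ∷ L) F                    ≈⟨ sumSub-cons x L F ⟩
    sumSub L F + sumSub L (F ∘ (x ∷_))  ≈⟨ +-congˡ (trans (sumSub-cong pL F[x∷S]≈aF[S]) (sumSub-*ˡ L a F)) ⟩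
    sumSub L F + a * sumSub L F         ≈⟨ +-comm _ _ ⟩
    a * sumSub L F + sumSub L F         ≈⟨ +-congˡ (*-identityˡ _) ⟨
    a * sumSub L F + 1# * sumSub L F    ≈⟨ distribʳ _ _ _ ⟨
    (a + 1#) * sumSub L F               ∎

  sumSub-free : ∀ {A : Set} {P : A → Set} L a F → All P L →
    (∀ {x S} → P x → All P S → F (x ∷ S) ≈ a * F S) → sumSub L F ≈ (a + 1#) ^ length L * F []
  sumSub-free [] a F [] _ = trans (+-identityʳ _) (sym (*-identityˡ _))
  sumSub-free (x ∷ L) a F (px ∷ pL) F[x∷S]≈aF[S] = begin
    sumSub (x ∷ L) F                          ≈⟨ sumSub-factor x a F pL (F[x∷S]≈aF[S] px) ⟩
    (a + 1#) * sumSub L F                     ≈⟨ *-congˡ (sumSub-free L a F pL F[x∷S]≈aF[S]) ⟩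
    (a + 1#) * ((a + 1#) ^ length L * F [])   ≈⟨ *-assoc _ _ _ ⟨
    (a + 1#) ^ length (x ∷ L) * F []          ∎

  sumSub-empty : ∀ {A : Set} {P : A → Set} L F → All P L → (∀ {w} S → P w → F (w ∷ S) ≈ 0#) → sumSub L F ≈ F []
  sumSub-empty [] F [] _ = +-identityʳ _
  sumSub-empty (w ∷ L) F (pw ∷ pL) F[w∷S]≈0 = begin
    sumSub (w ∷ L) F                      ≈⟨ sumSub-cons w L F ⟩
    sumSub L F + sumSub L (F ∘ (w ∷_))
      ≈⟨ +-cong (sumSub-empty L F pL F[w∷S]≈0) (trans (sumSub-congF L (λ S → F[w∷S]≈0 S pw)) (sumSub-zero L)) ⟩
    F [] + 0#                             ≈⟨ +-identityʳ _ ⟩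
    F []                                  ∎

  sumSub-atMostOne : ∀ {A : Set} {R : A → A → Set} L F → AllPairs R L →
    (∀ {x w} S → R x w → F (x ∷ w ∷ S) ≈ 0#) → sumSub L F ≈ F [] + sumOver L (λ x → F (x ∷ []))
  sumSub-atMostOne [] F [] _ = trans (+-identityʳ _) (sym (+-identityʳ _))
  sumSub-atMostOne (x ∷ L) F (Rx ∷ RL) F[x∷w∷S]≈0 = begin
    sumSub (x ∷ L) F                                    ≈⟨ sumSub-cons x L F ⟩
    sumSub L F + sumSub L (F ∘ (x ∷_))
      ≈⟨ +-cong (sumSub-atMostOne L F RL F[x∷w∷S]≈0) (sumSub-empty L (F ∘ (x ∷_)) Rx F[x∷w∷S]≈0) ⟩
    (F [] + sumOver L (λ x → F (x ∷ []))) + F (x ∷ [])  ≈⟨ +-assoc _ _ _ ⟩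
    F [] + (sumOver L (λ x → F (x ∷ [])) + F (x ∷ []))  ≈⟨ +-congˡ (+-comm _ _) ⟩
    F [] + sumOver (x ∷ L) (λ x → F (x ∷ []))           ∎

  if-*ˡ : ∀ b a w → (if b then a * w else 0#) ≈ a * (if b then w else 0#)
  if-*ˡ true a w = refl
  if-*ˡ false a w = sym (zeroʳ a)

  sumOver-filter : ∀ {A : Set} (q : A → Bool) (g : A → Carrier) xs →
    sumOver (filterᵇ q xs) g ≈ sumOver xs (λ x → if q x then g x else 0#)
  sumOver-filter q g [] = refl
  sumOver-filter q g (x ∷ xs) with q x
  ... | true = +-congˡ (sumOver-filter q g xs)
  ... | false = trans (sumOver-filter q g xs) (sym (+-identityˡ _))

module PowerSeries {c ℓ} (Rg : CommutativeRing c ℓ) where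
  open import Function using (_∘_)
  open import Data.Nat using (ℕ; zero; suc) renaming (_∸_ to _∸ℕ_)
  open import Data.List using (upTo; applyUpTo)
  open import Data.List.Properties using (map-applyUpTo)
  import Relation.Binary.PropositionalEquality as ≡

  open CommutativeRing Rg
  open Series Rg
  open SublistSums semiring using (sumOver; sumOver-map)
  open import Relation.Binary.Reasoning.Setoid setoid

  sumTo-cong : ∀ n {f g : ℕ → Carrier} → (∀ k → f k ≈ g k) → sumTo n f ≈ sumTo n g
  sumTo-cong zero f≈g = f≈g 0
  sumTo-cong (suc n) f≈g = +-cong (sumTo-cong n f≈g) (f≈g (suc n))

  sumTo-suc : ∀ n (f : ℕ → Carrier) → sumTo (suc n) f ≈ f 0 + sumTo n (f ∘ suc)
  sumTo-suc zero f = refl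
  sumTo-suc (suc n) f = trans (+-congʳ (sumTo-suc n f)) (+-assoc _ _ _)

  sumTo-head : ∀ n (f : ℕ → Carrier) → (∀ k → f (suc k) ≈ 0#) → sumTo n f ≈ f 0
  sumTo-head zero f _ = refl
  sumTo-head (suc n) f f[1+k]≈0 = trans (+-cong (sumTo-head n f f[1+k]≈0) (f[1+k]≈0 n)) (+-identityʳ _)

  sumTo-reverse : ∀ m (f : ℕ → Carrier) → sumTo m f ≈ f 0 + sumOver (upTo m) (λ t → f (m ∸ℕ t))
  sumTo-reverse zero f = sym (+-identityʳ _)
  sumTo-reverse (suc m) f = begin
    sumTo m f + f (suc m)                                                ≈⟨ +-congʳ (sumTo-reverse m f) ⟩
    (f 0 + sumOver (upTo m) (λ t → f (m ∸ℕ t))) + f (suc m)              ≈⟨ +-assoc _ _ _ ⟩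
    f 0 + (sumOver (upTo m) (λ t → f (m ∸ℕ t)) + f (suc m))              ≈⟨ +-congˡ (+-comm _ _) ⟩
    f 0 + (f (suc m) + sumOver (upTo m) (λ t → f (m ∸ℕ t)))              ≡⟨ ≡.cong (λ r → f 0 + (f (suc m) + r)) shiftIndex ⟨
    f 0 + sumOver (upTo (suc m)) (λ t → f (suc m ∸ℕ t))                  ∎
    where
    shiftIndex : sumOver (applyUpTo suc m) (λ t → f (suc m ∸ℕ t)) ≡.≡ sumOver (upTo m) (λ t → f (m ∸ℕ t))
    shiftIndex = ≡.trans (≡.cong (λ L → sumOver L (λ t → f (suc m ∸ℕ t))) (≡.sym (map-applyUpTo (λ t → t) suc m)))
      (sumOver-map suc (upTo m) (λ t → f (suc m ∸ℕ t)))

  ⊛-zero : ∀ f g → f 0 ≈ 0# → (f ⊛ g) 0 ≈ 0#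
  ⊛-zero f g f₀≈0 = trans (*-congʳ f₀≈0) (zeroˡ _)

  ⊛-suc : ∀ f g n → f 0 ≈ 0# → (f ⊛ g) (suc n) ≈ sumTo n (λ k → f (suc k) * g (n ∸ℕ k))
  ⊛-suc f g n f₀≈0 = trans (sumTo-suc n (λ k → f k * g (suc n ∸ℕ k))) (trans (+-congʳ (trans (*-congʳ f₀≈0) (zeroˡ _))) (+-identityˡ _))

  infix 4 _≋X*_

  _≋X*_ : PS → Carrier → Set ℓ
  f ≋X* a = ∀ k → f k ≈ X k * a

  ≋X*-⊛-zero : ∀ {f a} g → f ≋X* a → (f ⊛ g) 0 ≈ 0#
  ≋X*-⊛-zero {f} g f≋ax = ⊛-zero f g (trans (f≋ax 0) (zeroˡ _))

  ≋X*-⊛-suc : ∀ {f a} g n → f ≋X* a → (f ⊛ g) (suc n) ≈ a * g n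
  ≋X*-⊛-suc {f} {a} g n f≋ax = begin
    (f ⊛ g) (suc n)                             ≈⟨ ⊛-suc f g n (trans (f≋ax 0) (zeroˡ _)) ⟩
    sumTo n (λ k → f (suc k) * g (n ∸ℕ k))      ≈⟨ sumTo-head n _ (λ k → trans (*-congʳ (f[2+k]≈0 k)) (zeroˡ _)) ⟩
    f 1 * g n                                   ≈⟨ *-congʳ (trans (f≋ax 1) (*-identityˡ a)) ⟩
    a * g n                                     ∎
    where
    f[2+k]≈0 : ∀ k → f (suc (suc k)) ≈ 0#
    f[2+k]≈0 k = trans (f≋ax (suc (suc k))) (zeroˡ a)

  ≋X*-⊛-const : ∀ {f a} b → f ≋X* a → f ⊛ const b ≋X* a * b
  ≋X*-⊛-const {f} {a} b f≋ax zero = trans (≋X*-⊛-zero (const b) f≋ax) (sym (zeroˡ _))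
  ≋X*-⊛-const {f} {a} b f≋ax (suc zero) = trans (≋X*-⊛-suc (const b) 0 f≋ax) (sym (*-identityˡ _))
  ≋X*-⊛-const {f} {a} b f≋ax (suc (suc n)) = trans (≋X*-⊛-suc (const b) (suc n) f≋ax) (trans (zeroʳ a) (sym (zeroˡ _)))

  X⊛const≋X* : ∀ a → X ⊛ const a ≋X* a
  X⊛const≋X* a k = trans (≋X*-⊛-const a X≋X*1 k) (*-congˡ (*-identityˡ a))
    where
    X≋X*1 : X ≋X* 1#
    X≋X*1 k = sym (*-identityʳ (X k))

module Recurrence {c ℓ} (Rg : CommutativeRing c ℓ) (y z s : CommutativeRing.Carrier Rg) where
  open Board
  open import Function using (_∘_; _$_)
  open import Data.Nat using (ℕ; zero; suc; _≤_; _<_; z≤n; s≤s; _<ᵇ_; _≡ᵇ_) renaming (_+_ to _+ℕ_; _∸_ to _∸ℕ_)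
  import Data.Nat.Properties as ℕ
  open import Data.Bool using (Bool; true; false; _∧_; _∨_; not; if_then_else_)
  open import Data.Bool.Properties using (∧-zeroʳ)
  open import Data.Product using (_,_; proj₁; proj₂)
  open import Data.Sum using (_⊎_; inj₁; inj₂)
  open import Relation.Nullary using (yes; no)
  open import Data.List using (List; []; _∷_; _++_; map; foldr; filterᵇ; length; upTo)
  open import Data.List.Properties using (map-applyUpTo)
  open import Data.List.Relation.Unary.All as All using (All; []; _∷_)
  import Data.List.Relation.Unary.All.Properties as All
  open import Data.Bool.ListAction using (all; any)
  import Relation.Binary.PropositionalEquality as ≡
  open ≡ using (_≡_; _≢_)

  open CommutativeRing Rg
  open Series.Weights Rg y z s
  open SublistSums semiring
  open import Algebra.Definitions.RawSemiring (Semiring.rawSemiring semiring) using (_^_)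
  open import Relation.Binary.Reasoning.Setoid setoid
  open import Algebra.Properties.CommutativeSemigroup *-commutativeSemigroup using (x∙yz≈y∙xz)

  columnMate : Cell → Cell → Bool
  columnMate w u = not (sameCell u w) ∧ (proj₂ u ≡ᵇ proj₂ w)

  columnMate-false : ∀ {w u} → proj₂ u ≢ proj₂ w → columnMate w u ≡ false
  columnMate-false {w} {u} col≢ = ≡.trans (≡.cong (not (sameCell u w) ∧_) (≡ᵇ-false col≢)) (∧-zeroʳ _)

  any-insert : ∀ {A : Set} (p : A → Bool) P {u} I → p u ≡ false → any p (P ++ u ∷ I) ≡ any p (P ++ I)
  any-insert p [] I pu rewrite pu = ≡.refl
  any-insert p (x ∷ P) I pu = ≡.cong (p x ∨_) (any-insert p P I pu)

  ψ-insert : ∀ P {u w} I → columnMate w u ≡ false → ψ (P ++ u ∷ I) w ≡ ψ (P ++ I) w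
  ψ-insert P {w = i , j} I mate = ≡.cong (λ b → if i <ᵇ j then y else (if b then z else s)) (any-insert (columnMate (i , j)) P I mate)

  ψ-mate : ∀ {x w} I J → columnMate w x ≡ true → ψ (x ∷ I) w ≡ ψ (x ∷ J) w
  ψ-mate {w = i , j} I J mate rewrite mate = ≡.refl

  ψ-shift : ∀ I v → ψ (map (shift 1) I) (shift 1 v) ≡ ψ I v
  ψ-shift I (i , j) = ≡.cong (λ b → if i <ᵇ j then y else (if b then z else s)) (any-map (columnMate (suc i , suc j)) (shift 1) I)

  ψ-offDiag : ∀ I {i j} → i < j → ψ I (i , j) ≡ y
  ψ-offDiag I i<j rewrite <ᵇ-true i<j = ≡.refl

  ψ-insert-column : ∀ {j r} S {w} → 2 ≤ proj₁ w → ψ ((1 , j) ∷ (r , j) ∷ S) w ≡ ψ ((1 , j) ∷ S) w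
  ψ-insert-column {j} {r} S {w} 2≤row with proj₂ w ℕ.≟ j
  ... | yes ≡.refl = ψ-mate {1 , j} {w} ((r , j) ∷ S) S mate
    where
    mate : columnMate w (1 , j) ≡ true
    mate rewrite ≡ᵇ-false {1} {proj₁ w} (ℕ.<⇒≢ 2≤row) | ≡ᵇ-refl j = ≡.refl
  ... | no col≢j = ψ-insert ((1 , j) ∷ []) {r , j} {w} S (columnMate-false {w} {r , j} (col≢j ∘ ≡.sym))

  weightIn : List Cell → List Cell → Carrier
  weightIn I S = foldr (λ v acc → ψ I v * acc) 1# S

  weightIn-cong : ∀ I J S → All (λ w → ψ I w ≡ ψ J w) S → weightIn I S ≡ weightIn J S
  weightIn-cong I J [] [] = ≡.refl
  weightIn-cong I J (v ∷ S) (ψv ∷ ψS) = ≡.cong₂ _*_ ψv (weightIn-cong I J S ψS)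

  weightIn-shift : ∀ I S → weightIn (map (shift 1) I) (map (shift 1) S) ≡ weightIn I S
  weightIn-shift I [] = ≡.refl
  weightIn-shift I (v ∷ S) = ≡.cong₂ _*_ (ψ-shift I v) (weightIn-shift I S)

  -- The weight of S as a set of cells of an independent set P ++ S, or 0 if S is not independent.
  indWeight : List Cell → List Cell → Carrier
  indWeight P S = if indep S then weightIn (P ++ S) S else 0#

  indWeight-insert : ∀ P {v S a} → All (λ w → adj v w ≡ false) S → ψ (P ++ v ∷ S) v ≡ a →
    All (λ w → ψ (P ++ v ∷ S) w ≡ ψ (P ++ S) w) S → indWeight P (v ∷ S) ≈ a * indWeight P S
  indWeight-insert P {v} {S} {a} v≁S ψv ψS = begin
    indWeight P (v ∷ S)
      ≡⟨ ≡.cong₂ (λ b w → if b ∧ indep S then w else 0#) v≁S′ (≡.cong₂ _*_ ψv (weightIn-cong (P ++ v ∷ S) (P ++ S) S ψS)) ⟩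
    (if indep S then a * weightIn (P ++ S) S else 0#)
      ≈⟨ if-*ˡ (indep S) a _ ⟩
    a * indWeight P S ∎
    where
    v≁S′ : all (not ∘ adj v) S ≡ true
    v≁S′ = all-true (not ∘ adj v) (All.map (≡.cong not) v≁S)

  indWeight-context : ∀ P Q {S} → All (λ w → ψ (P ++ S) w ≡ ψ (Q ++ S) w) S → indWeight P S ≡ indWeight Q S
  indWeight-context P Q {S} ψS = ≡.cong (λ w → if indep S then w else 0#) (weightIn-cong (P ++ S) (Q ++ S) S ψS)

  indWeight-shift : ∀ S → indWeight [] (map (shift 1) S) ≡ indWeight [] S
  indWeight-shift S = ≡.cong₂ (λ b w → if b then w else 0#) (indep-shift S) (weightIn-shift S S)

  indWeight-adj : ∀ {x w} S → adj x w ≡ true → indWeight [] (x ∷ w ∷ S) ≡ 0#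
  indWeight-adj S x∼w rewrite x∼w = ≡.refl

  sumSub-shift : ∀ a L → sumSub (map (shift a) L) (indWeight []) ≈ sumSub L (indWeight [])
  sumSub-shift zero L = reflexive (≡.cong (λ L → sumSub L (indWeight [])) (map-shift-zero L))
  sumSub-shift (suc a) L = begin
    sumSub (map (shift (suc a)) L) (indWeight [])                     ≡⟨ ≡.cong (λ L → sumSub L (indWeight [])) (map-shift-suc a L) ⟩
    sumSub (map (shift a) (map (shift 1) L)) (indWeight [])           ≈⟨ sumSub-shift a (map (shift 1) L) ⟩
    sumSub (map (shift 1) L) (indWeight [])                           ≈⟨ sumSub-map (shift 1) L (indWeight []) ⟩
    sumSub L (indWeight [] ∘ map (shift 1))                           ≈⟨ sumSub-congF L (reflexive ∘ indWeight-shift) ⟩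
    sumSub L (indWeight [])                                           ∎

  R≈sumSub-board : ∀ n → R n ≈ sumSub (board n) (indWeight [])
  R≈sumSub-board n = begin
    R n                              ≈⟨ sumOver-filter (independent n) weight (subsets (cells n)) ⟩
    sumSub (cells n) weightIfIndep   ≡⟨ ≡.cong (λ L → sumSub L weightIfIndep) (cells≡board n) ⟩
    sumSub (board n) weightIfIndep   ≈⟨ sumSub-cong (board-InBoard n) (reflexive ∘ independent≡indep′) ⟩
    sumSub (board n) (indWeight [])  ∎
    where
    weightIfIndep : List Cell → Carrier
    weightIfIndep I = if independent n I then weight I else 0#
    independent≡indep′ : ∀ {S} → All (InBoard n) S → weightIfIndep S ≡ indWeight [] S
    independent≡indep′ {S} S⊆B = ≡.cong (λ b → if b then weight S else 0#) (independent≡indep S⊆B)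

  R-suc≈corner : ∀ m → R (suc m) ≈ (s + 1#) * sumSub (board∖corner m) (indWeight [])
  R-suc≈corner m = trans (R≈sumSub-board (suc m)) (sumSub-factor (1 , 1) s (indWeight []) (board∖corner-OffFirstColumn m) corner)
    where
    corner : ∀ {S} → All OffFirstColumn S → indWeight [] ((1 , 1) ∷ S) ≈ s * indWeight [] S
    corner {S} S⊆ = indWeight-insert [] {1 , 1}
      (All.map (λ { {i , j} (1≤i , 2≤j , _) → diagonal-nonadj 1≤i 2≤j }) S⊆)
      ψ[1,1]≡s
      (All.map (λ { {w} (_ , 2≤j , _) → ψ-insert [] {1 , 1} {w} S (columnMate-false {w} {1 , 1} (ℕ.<⇒≢ 2≤j)) }) S⊆)
      where
      ψ[1,1]≡s : ψ ((1 , 1) ∷ S) (1 , 1) ≡ s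
      ψ[1,1]≡s = ≡.cong (λ b → if b then z else s) $ any-false (columnMate (1 , 1)) $
        All.map (λ { {w} (_ , 2≤j , _) → columnMate-false {1 , 1} {w} (ℕ.>⇒≢ 2≤j) }) S⊆

  sumSub-board∖corner : ∀ m → let D = map (shift 1) (board m) in
    sumSub (board∖corner m) (indWeight []) ≈ sumSub D (indWeight []) + sumOver (upTo m) (λ t → sumSub D (indWeight [] ∘ (topCell t ∷_)))
  sumSub-board∖corner m = begin
    sumSub (topRow m ++ D) F
      ≈⟨ sumSub-++ (topRow m) D F ⟩
    sumSub (topRow m) (λ T → sumSub D (F ∘ (T ++_)))
      ≈⟨ sumSub-atMostOne (topRow m) _ (topRow-adj m) (λ {x} {w} → adjacentPair-vanishes {x} {w}) ⟩
    sumSub D F + sumOver (topRow m) (λ x → sumSub D (F ∘ (x ∷_)))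
      ≡⟨ ≡.cong (λ L → sumSub D F + sumOver L (λ x → sumSub D (F ∘ (x ∷_)))) (≡.sym (map-applyUpTo (λ t → t) topCell m)) ⟩
    sumSub D F + sumOver (map topCell (upTo m)) (λ x → sumSub D (F ∘ (x ∷_)))
      ≡⟨ ≡.cong (sumSub D F +_) (sumOver-map topCell (upTo m) _) ⟩
    sumSub D F + sumOver (upTo m) (λ t → sumSub D (F ∘ (topCell t ∷_))) ∎
    where
    D = map (shift 1) (board m)
    F = indWeight []
    adjacentPair-vanishes : ∀ {x w} T → adj x w ≡ true → sumSub D (F ∘ ((x ∷ w ∷ T) ++_)) ≈ 0#
    adjacentPair-vanishes {x} {w} T x∼w = trans (sumSub-congF D λ S → reflexive (indWeight-adj {x} {w} (T ++ S) x∼w)) (sumSub-zero D)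

  module _ (t : ℕ) where

    private
      x = topCell t
      j = suc (suc t)

    indWeight-topCell : ∀ S → indWeight [] (x ∷ S) ≈ (if all (compatible t) S then y * indWeight (x ∷ []) S else 0#)
    indWeight-topCell S with all (compatible t) S
    ... | true = if-*ˡ (indep S) y _
    ... | false = refl

    column-factor : ∀ {v S} → ColumnAbove j v → All (λ w → ColumnAbove j w ⊎ Below j w) S →
      indWeight (x ∷ []) (v ∷ S) ≈ y * indWeight (x ∷ []) S
    column-factor {r , .j} {S} (2≤r , r<j , ≡.refl) S⊆ = indWeight-insert (x ∷ []) {r , j}
      (All.map (λ { {w} (inj₁ (_ , r'<j , ≡.refl)) → sameColumn-nonadj r<j r'<j
                  ; {w} (inj₂ (j≤r' , r'≤c')) → belowDiagonal-nonadj r<j j≤r' r'≤c' }) S⊆)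
      (ψ-offDiag (x ∷ (r , j) ∷ S) r<j)
      (All.map (λ { {w} (inj₁ (2≤r' , _)) → ψ-insert-column {j} {r} S {w} 2≤r'
                  ; {w} (inj₂ (j≤r' , _)) → ψ-insert-column {j} {r} S {w} (ℕ.≤-trans (s≤s (s≤s z≤n)) j≤r') }) S⊆)

    diagonal-factor : ∀ {S} → All (SouthEast j) S → indWeight (x ∷ []) ((j , j) ∷ S) ≈ z * indWeight (x ∷ []) S
    diagonal-factor {S} S⊆ = indWeight-insert (x ∷ []) {j , j}
      (All.map (λ { (j≤r , j<c) → diagonal-nonadj j≤r j<c }) S⊆)
      ψ[j,j]≡z
      (All.map (λ { {w} (_ , j<c) → ψ-insert (x ∷ []) {j , j} {w} S (columnMate-false {w} {j , j} (ℕ.<⇒≢ j<c)) }) S⊆)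
      where
      ψ[j,j]≡z : ψ (x ∷ (j , j) ∷ S) (j , j) ≡ z
      ψ[j,j]≡z rewrite <ᵇ-false {t} {t} ℕ.≤-refl | ≡ᵇ-refl t = ≡.refl

    drop-topCell : ∀ {S} → All (SouthEast j) S → indWeight (x ∷ []) S ≡ indWeight [] S
    drop-topCell {S} S⊆ = indWeight-context (x ∷ []) []
      (All.map (λ { {w} (_ , j<c) → ψ-insert [] {x} {w} S (columnMate-false {w} {x} (ℕ.<⇒≢ j<c)) }) S⊆)

    topCell-sum : ∀ k → sumSub (map (shift 1) (board (t +ℕ suc k))) (indWeight [] ∘ (x ∷_))
      ≈ y * ((y + 1#) ^ t * ((z + 1#) * sumSub (board∖corner k) (indWeight [])))
    topCell-sum k = begin
      sumSub D (indWeight [] ∘ (x ∷_))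
        ≈⟨ sumSub-congF D indWeight-topCell ⟩
      sumSub D (λ S → if all (compatible t) S then y * Fₓ S else 0#)
        ≈⟨ sumSub-filter (compatible t) D (λ S → y * Fₓ S) ⟩
      sumSub (filterᵇ (compatible t) D) (λ S → y * Fₓ S)
        ≈⟨ sumSub-*ˡ (filterᵇ (compatible t) D) y Fₓ ⟩
      y * sumSub (filterᵇ (compatible t) D) Fₓ
        ≡⟨ ≡.cong (λ L → y * sumSub L Fₓ) (filter-compatible t k t 0 ≡.refl) ⟩
      y * sumSub (column t 0 t ++ Dⱼ) Fₓ
        ≈⟨ *-congˡ (sumSub-++ (column t 0 t) Dⱼ Fₓ) ⟩
      y * sumSub (column t 0 t) (λ C → sumSub Dⱼ (Fₓ ∘ (C ++_)))
        ≈⟨ *-congˡ (sumSub-free (column t 0 t) y _ (column-ColumnAbove t 0 t ℕ.≤-refl) columnStep) ⟩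
      y * ((y + 1#) ^ length (column t 0 t) * sumSub Dⱼ Fₓ)
        ≡⟨ ≡.cong₂ (λ n L → y * ((y + 1#) ^ n * sumSub L Fₓ)) (length-column t 0 t) (shiftedBoard-suc t k) ⟩
      y * ((y + 1#) ^ t * sumSub ((j , j) ∷ D′) Fₓ)
        ≈⟨ *-congˡ (*-congˡ (sumSub-factor (j , j) z Fₓ (shifted∖corner-SouthEast t k) diagonal-factor)) ⟩
      y * ((y + 1#) ^ t * ((z + 1#) * sumSub D′ Fₓ))
        ≈⟨ *-congˡ (*-congˡ (*-congˡ (sumSub-cong (shifted∖corner-SouthEast t k) (reflexive ∘ drop-topCell)))) ⟩
      y * ((y + 1#) ^ t * ((z + 1#) * sumSub D′ (indWeight [])))
        ≈⟨ *-congˡ (*-congˡ (*-congˡ (sumSub-shift (suc t) (board∖corner k)))) ⟩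
      y * ((y + 1#) ^ t * ((z + 1#) * sumSub (board∖corner k) (indWeight []))) ∎
      where
      D = map (shift 1) (board (t +ℕ suc k))
      Dⱼ = map (shift (suc t)) (board (suc k))
      D′ = map (shift (suc t)) (board∖corner k)
      Fₓ = indWeight (x ∷ [])
      columnStep : ∀ {v C} → ColumnAbove j v → All (ColumnAbove j) C →
        sumSub Dⱼ (Fₓ ∘ ((v ∷ C) ++_)) ≈ y * sumSub Dⱼ (Fₓ ∘ (C ++_))
      columnStep v∈ C⊆ = trans
        (sumSub-cong (shiftedBoard-Below t (suc k)) (λ S⊆ → column-factor v∈ (All.++⁺ (All.map inj₁ C⊆) (All.map inj₂ S⊆))))
        (sumSub-*ˡ Dⱼ y _)

  R-suc : ∀ m → R (suc m) ≈ (s + 1#) * R m + sumOver (upTo m) (λ t → y * ((y + 1#) ^ t * ((z + 1#) * R (m ∸ℕ t))))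
  R-suc m = begin
    R (suc m)
      ≈⟨ R-suc≈corner m ⟩
    (s + 1#) * sumSub (board∖corner m) F
      ≈⟨ *-congˡ (sumSub-board∖corner m) ⟩
    (s + 1#) * (sumSub D F + sumOver (upTo m) G)
      ≈⟨ distribˡ (s + 1#) _ _ ⟩
    (s + 1#) * sumSub D F + (s + 1#) * sumOver (upTo m) G
      ≈⟨ +-cong (*-congˡ (trans (sumSub-shift 1 (board m)) (sym (R≈sumSub-board m)))) (sym (sumOver-*ˡ (upTo m) (s + 1#) G)) ⟩
    (s + 1#) * R m + sumOver (upTo m) (λ t → (s + 1#) * G t)
      ≈⟨ +-congˡ (sumOver-cong (All.all-upTo m) topCell-term) ⟩
    (s + 1#) * R m + sumOver (upTo m) (λ t → y * ((y + 1#) ^ t * ((z + 1#) * R (m ∸ℕ t)))) ∎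
    where
    D = map (shift 1) (board m)
    F = indWeight []
    G = λ t → sumSub D (F ∘ (topCell t ∷_))
    topCell-term : ∀ {t} → t < m → (s + 1#) * G t ≈ y * ((y + 1#) ^ t * ((z + 1#) * R (m ∸ℕ t)))
    topCell-term {t} t<m = begin
      (s + 1#) * G t
        ≡⟨ ≡.cong (λ n → (s + 1#) * sumSub (map (shift 1) (board n)) (F ∘ (topCell t ∷_))) (≡.sym t+1+k≡m) ⟩
      (s + 1#) * sumSub (map (shift 1) (board (t +ℕ suc k))) (F ∘ (topCell t ∷_))
        ≈⟨ *-congˡ (topCell-sum t k) ⟩
      (s + 1#) * (y * ((y + 1#) ^ t * ((z + 1#) * B)))
        ≈⟨ x∙yz≈y∙xz (s + 1#) y _ ⟩
      y * ((s + 1#) * ((y + 1#) ^ t * ((z + 1#) * B)))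
        ≈⟨ *-congˡ (trans (x∙yz≈y∙xz (s + 1#) _ _) (*-congˡ (x∙yz≈y∙xz (s + 1#) _ _))) ⟩
      y * ((y + 1#) ^ t * ((z + 1#) * ((s + 1#) * B)))
        ≈⟨ *-congˡ (*-congˡ (*-congˡ (sym (R-suc≈corner k)))) ⟩
      y * ((y + 1#) ^ t * ((z + 1#) * R (suc k)))
        ≡⟨ ≡.cong (λ n → y * ((y + 1#) ^ t * ((z + 1#) * R n))) (≡.sym m∸t≡1+k) ⟩
      y * ((y + 1#) ^ t * ((z + 1#) * R (m ∸ℕ t))) ∎
      where
      k = m ∸ℕ suc t
      B = sumSub (board∖corner k) F
      t+1+k≡m : t +ℕ suc k ≡ m
      t+1+k≡m = ≡.trans (ℕ.+-suc t k) (ℕ.m+[n∸m]≡n t<m)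
      m∸t≡1+k : m ∸ℕ t ≡ suc k
      m∸t≡1+k = ≡.trans (≡.cong (_∸ℕ t) (≡.sym t+1+k≡m)) (ℕ.m+n∸m≡n t (suc k))

module Coefficients {c ℓ} (Rg : CommutativeRing c ℓ) (y z s : CommutativeRing.Carrier Rg) where
  open import Data.Nat using (ℕ; zero; suc; _<_) renaming (_∸_ to _∸ℕ_)
  import Data.Nat.Properties as ℕ
  open import Data.List using (upTo)
  import Data.List.Relation.Unary.All.Properties as All
  import Relation.Binary.PropositionalEquality as ≡

  open CommutativeRing Rg
  open Series Rg
  open Series.Weights Rg y z s
  open PowerSeries Rg
  open SublistSums semiring using (sumOver; sumOver-cong)
  open import Algebra.Definitions.RawSemiring (Semiring.rawSemiring semiring) using (_^_)
  open import Relation.Binary.Reasoning.Setoid setoid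
  open import Algebra.Properties.Ring ring using (-0#≈0#)

  B = (X ⊛ const y) ⊛ const (z + 1#)
  C = B ⊛ (R ⊖ const 1#)

  B≋X* : B ≋X* y * (z + 1#)
  B≋X* = ≋X*-⊛-const (z + 1#) (X⊛const≋X* y)

  pow≈^ : ∀ a k → pow a k ≈ a ^ k
  pow≈^ a zero = refl
  pow≈^ a (suc k) = *-congˡ (pow≈^ a k)

  R-zero : R 0 ≈ 1#
  R-zero = +-identityʳ 1#

  C-zero : C 0 ≈ 0#
  C-zero = ≋X*-⊛-zero (R ⊖ const 1#) B≋X*

  C⊛geom-suc : ∀ m → (C ⊛ geom (y + 1#)) (suc m) ≈ sumOver (upTo m) (λ t → y * ((y + 1#) ^ t * ((z + 1#) * R (m ∸ℕ t))))
  C⊛geom-suc m = begin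
    (C ⊛ geom (y + 1#)) (suc m)                                 ≈⟨ ⊛-suc C (geom (y + 1#)) m C-zero ⟩
    sumTo m (λ k → C (suc k) * geom (y + 1#) (m ∸ℕ k))          ≈⟨ sumTo-cong m (λ k → *-congʳ (≋X*-⊛-suc (R ⊖ const 1#) k B≋X*)) ⟩
    sumTo m h                                                    ≈⟨ sumTo-reverse m h ⟩
    h 0 + sumOver (upTo m) (λ t → h (m ∸ℕ t))                   ≈⟨ +-congʳ h₀≈0 ⟩
    0# + sumOver (upTo m) (λ t → h (m ∸ℕ t))                    ≈⟨ +-identityˡ _ ⟩
    sumOver (upTo m) (λ t → h (m ∸ℕ t))                         ≈⟨ sumOver-cong (All.all-upTo m) h[m∸t] ⟩
    sumOver (upTo m) (λ t → y * ((y + 1#) ^ t * ((z + 1#) * R (m ∸ℕ t)))) ∎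
    where
    h : ℕ → Carrier
    h k = y * (z + 1#) * (R k - const 1# k) * geom (y + 1#) (m ∸ℕ k)
    h₀≈0 : h 0 ≈ 0#
    h₀≈0 = trans (*-congʳ (trans (*-congˡ (trans (+-congʳ R-zero) (-‿inverseʳ 1#))) (zeroʳ _))) (zeroˡ _)
    h[m∸t] : ∀ {t} → t < m → h (m ∸ℕ t) ≈ y * ((y + 1#) ^ t * ((z + 1#) * R (m ∸ℕ t)))
    h[m∸t] {t} t<m = begin
      y * (z + 1#) * (R (m ∸ℕ t) - const 1# (m ∸ℕ t)) * geom (y + 1#) (m ∸ℕ (m ∸ℕ t))
        ≡⟨ ≡.cong₂ (λ a b → y * (z + 1#) * (R (m ∸ℕ t) - const 1# a) * geom (y + 1#) b)
             (ℕ.+-∸-assoc 1 t<m) (ℕ.m∸[m∸n]≡n (ℕ.<⇒≤ t<m)) ⟩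
      y * (z + 1#) * (R (m ∸ℕ t) - 0#) * pow (y + 1#) t
        ≈⟨ *-cong (*-congˡ (trans (+-congˡ -0#≈0#) (+-identityʳ _))) (pow≈^ (y + 1#) t) ⟩
      y * (z + 1#) * R (m ∸ℕ t) * (y + 1#) ^ t
        ≈⟨ trans (*-congʳ (*-assoc _ _ _)) (*-assoc _ _ _) ⟩
      y * ((z + 1#) * R (m ∸ℕ t) * (y + 1#) ^ t)
        ≈⟨ *-congˡ (*-comm _ _) ⟩
      y * ((y + 1#) ^ t * ((z + 1#) * R (m ∸ℕ t))) ∎

proposition10p4 : {c ℓ : Level} (Rg : CommutativeRing c ℓ) →
    let open CommutativeRing Rg
        open Series Rg
        open Weights in
    (y z s : Carrier) →
    R y z s ≋ (const 1# ⊕ ((X ⊛ const (s + 1#)) ⊛ R y z s)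
      ⊕ ((((X ⊛ const y) ⊛ const (z + 1#)) ⊛ (R y z s ⊖ const 1#)) ⊛ geom (y + 1#)))
proposition10p4 Rg y z s = coefficientwise
  where
  open CommutativeRing Rg
  open Series Rg
  open Series.Weights Rg y z s
  open PowerSeries Rg
  open Coefficients Rg y z s
  open Recurrence Rg y z s using (R-suc)
  open SetoidReasoning setoid

  coefficientwise : R ≋ (const 1# ⊕ ((X ⊛ const (s + 1#)) ⊛ R) ⊕ (C ⊛ geom (y + 1#)))
  coefficientwise zero = begin
    R 0                                                  ≈⟨ R-zero ⟩
    1#                                                   ≈⟨ +-identityʳ 1# ⟨
    1# + 0#                                              ≈⟨ +-identityʳ _ ⟨
    1# + 0# + 0#
      ≈⟨ +-cong (+-congˡ (≋X*-⊛-zero R (X⊛const≋X* (s + 1#)))) (⊛-zero C (geom (y + 1#)) C-zero) ⟨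
    1# + ((X ⊛ const (s + 1#)) ⊛ R) 0 + (C ⊛ geom (y + 1#)) 0 ∎
  coefficientwise (suc m) = begin
    R (suc m)
      ≈⟨ R-suc m ⟩
    (s + 1#) * R m + _
      ≈⟨ +-cong (≋X*-⊛-suc R m (X⊛const≋X* (s + 1#))) (C⊛geom-suc m) ⟨
    ((X ⊛ const (s + 1#)) ⊛ R) (suc m) + (C ⊛ geom (y + 1#)) (suc m)
      ≈⟨ +-congʳ (+-identityˡ _) ⟨
    0# + ((X ⊛ const (s + 1#)) ⊛ R) (suc m) + (C ⊛ geom (y + 1#)) (suc m) ∎
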